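{- Let $r\ge 3$ and let $\beta$ be a vector of positive integers of length $r-1$ such that every finite digraph $D'$ without $(r-2)$-source sets contains a $\beta$-kernel. Let $D$ be a finite digraph which contains no $(r-2)$-pseudo-source sets. Then for every independent set $Q\subseteq V(D)$, there exist pairwise disjoint sets $Q_1,\dots,Q_{r-1}\subseteq V(D)\setminus Q$ such that each $Q_i$ is a $(2\beta_i+1)$-kernel of $D$.
   Context: For $S\subseteq V(D)$, $N^-(S)=\{u\in V(D)\setminus S:\exists v\in S,\ uv\in E(D)\}$. $S$ is a source set if $N^-(S)=\emptyset$; it is an $s$-source set if additionally $S\ne\emptyset$ and $|S|\le s$. A non-empty set $S$ is a pseudo-source set if every $v\in N^-(S)$ satisfies $N^-(\{v\})\subseteq S$ (equivalently $N^-(S)$ is independent and $S\cup N^-(S)$ is a source set); it is an $s$-pseudo-source set if also $|S|\le s$. A set is independent if there are no arcs between two of its vertices. $\mathrm{dist}(S,v)$ is the minimum over $u\in S$ of the length of a shortest directed path from $u$ to $v$. A $q$-kernel is an independent set $Q$ with $\mathrm{dist}(Q,v)\le q$ for all $v$. For a vector $\beta$ of length $m$, a $\beta$-kernel is a tuple $(Q_1,\dots,Q_m)$ of pairwise disjoint vertex sets with each $Q_i$ a $\beta_i$-kernel. -}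

module Defs where

open import Data.Nat using (ℕ; zero; suc; _≤_; _+_; _*_)
open import Data.Bool using (Bool; true; false)
open import Data.Fin using (Fin)
open import Data.Fin.Subset using (Subset; _∈_; _∉_; ∣_∣; Nonempty)
open import Data.Vec using (Vec; lookup)
open import Data.Product using (Σ; ∃; _×_; ∃-syntax)
open import Relation.Nullary using (¬_)
open import Relation.Binary.PropositionalEquality using (_≡_; _≢_)

record Digraph : Set where
  field
    size     : ℕ
    arc      : Fin size → Fin size → Bool
    loopless : ∀ v → arc v v ≡ false
open Digraph public

module _ (D : Digraph) where
  private
    V = Fin (size D)

  Arc : V → V → Set
  Arc u v = arc D u v ≡ true

  InNeg : Subset (size D) → V → Set
  InNeg S u = u ∉ S × (∃[ v ] (v ∈ S × Arc u v))

  SourceSet : Subset (size D) → Set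
  SourceSet S = ∀ u → ¬ InNeg S u

  IsSSource : ℕ → Subset (size D) → Set
  IsSSource s S = Nonempty S × ∣ S ∣ ≤ s × SourceSet S

  PseudoSource : Subset (size D) → Set
  PseudoSource S =
    Nonempty S × (∀ v → InNeg S v → ∀ u → Arc u v → u ≢ v → u ∈ S)

  IsSPseudoSource : ℕ → Subset (size D) → Set
  IsSPseudoSource s S = PseudoSource S × ∣ S ∣ ≤ s

  Independent : Subset (size D) → Set
  Independent Q = ∀ u v → u ∈ Q → v ∈ Q → ¬ Arc u v

  data Walk : V → V → ℕ → Set where
    here : ∀ {u} → Walk u u zero
    step : ∀ {u w v k} → Arc u w → Walk w v k → Walk u v (suc k)

  DistLe : Subset (size D) → V → ℕ → Set
  DistLe S v q = ∃[ u ] ∃[ k ] (u ∈ S × k ≤ q × Walk u v k)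

  IsQKernel : ℕ → Subset (size D) → Set
  IsQKernel q Q = Independent Q × (∀ v → DistLe Q v q)

  PairwiseDisjoint : ∀ {m} → (Fin m → Subset (size D)) → Set
  PairwiseDisjoint Qs = ∀ i j → i ≢ j → ∀ v → v ∈ Qs i → v ∉ Qs j

  IsBetaKernel : ∀ {m} → Vec ℕ m → (Fin m → Subset (size D)) → Set
  IsBetaKernel β Qs = PairwiseDisjoint Qs × (∀ i → IsQKernel (lookup β i) (Qs i))

  HasBetaKernel : ∀ {m} → Vec ℕ m → Set
  HasBetaKernel {m} β = Σ (Fin m → Subset (size D)) (IsBetaKernel β)

-- Delete the independent set Q and join u to v whenever v is within distance
-- two of u in D.  A source set S of this digraph D² − Q, read back in D, is a
-- pseudo-source set: an in-neighbour of S outside Q would be an in-neighbour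
-- in D² − Q, and an in-neighbour v ∈ Q has all its own in-neighbours outside
-- Q (independence), hence at distance two from S, hence inside S.  So D² − Q
-- has no (r−2)-source set and the hypothesis yields a β-kernel of it.  A
-- β_i-kernel of D² − Q reaches every vertex outside Q within 2β_i steps of D,
-- and every vertex of Q, which has an in-neighbour since {v} is not a
-- pseudo-source set, within 2β_i + 1 steps.
module Submission where

open import Defs
open import Data.Nat using (ℕ; suc; _≤_; _∸_; _+_; _*_; z≤n; s≤s)
open import Data.Nat.Properties
  using (≤-trans; ≤-reflexive; m≤n⇒m≤1+n; m≤m+n; *-suc; *-monoʳ-≤; +-monoˡ-≤; ∸-monoˡ-≤)
open import Data.Fin using (Fin; zero; suc)
open import Data.Fin.Properties using (any?) renaming (_≟_ to _≟ᶠ_)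
open import Data.Fin.Subset using (Subset; _∈_; _∉_; ∣_∣; ⁅_⁆)
open import Data.Fin.Subset.Properties using (_∈?_; x∈⁅x⁆; x∈⁅y⁆⇒x≡y; ∣⁅x⁆∣≡1)
open import Data.Vec using (Vec; lookup; []; _∷_; here; there)
open import Data.Bool using (true; false)
open import Data.Bool.Properties using () renaming (_≟_ to _≟ᵇ_)
open import Data.Product using (_×_; ∃-syntax; _,_; proj₁)
open import Data.Sum using (_⊎_; inj₁; inj₂)
open import Data.Empty using (⊥-elim)
open import Function using (_∘_)
open import Relation.Nullary using (¬_; Dec; yes; no; does; ¬?)
open import Relation.Nullary.Decidable using (_×-dec_; _⊎-dec_; dec-true; dec-false)
open import Relation.Binary.PropositionalEquality using (_≡_; _≢_; refl; sym; trans; cong; subst)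

sizeOutside : ∀ {n} → Subset n → ℕ
sizeOutside []          = 0
sizeOutside (true ∷ Q)  = sizeOutside Q
sizeOutside (false ∷ Q) = suc (sizeOutside Q)

fromOutside : ∀ {n} (Q : Subset n) → Fin (sizeOutside Q) → Fin n
fromOutside (true ∷ Q)  i       = suc (fromOutside Q i)
fromOutside (false ∷ Q) zero    = zero
fromOutside (false ∷ Q) (suc i) = suc (fromOutside Q i)

liftSubset : ∀ {n} (Q : Subset n) → Subset (sizeOutside Q) → Subset n
liftSubset []          S       = []
liftSubset (true ∷ Q)  S       = false ∷ liftSubset Q S
liftSubset (false ∷ Q) (b ∷ S) = b ∷ liftSubset Q S

∣liftSubset∣ : ∀ {n} (Q : Subset n) S → ∣ liftSubset Q S ∣ ≡ ∣ S ∣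
∣liftSubset∣ []          []          = refl
∣liftSubset∣ (true ∷ Q)  S           = ∣liftSubset∣ Q S
∣liftSubset∣ (false ∷ Q) (true ∷ S)  = cong suc (∣liftSubset∣ Q S)
∣liftSubset∣ (false ∷ Q) (false ∷ S) = ∣liftSubset∣ Q S

fromOutside∉ : ∀ {n} (Q : Subset n) i → fromOutside Q i ∉ Q
fromOutside∉ (true ∷ Q)  i       (there p) = fromOutside∉ Q i p
fromOutside∉ (false ∷ Q) (suc i) (there p) = fromOutside∉ Q i p

fromOutside-onto : ∀ {n} (Q : Subset n) v → v ∉ Q → ∃[ i ] fromOutside Q i ≡ v
fromOutside-onto (true ∷ Q)  zero    v∉ = ⊥-elim (v∉ here)
fromOutside-onto (false ∷ Q) zero    v∉ = zero , refl
fromOutside-onto (true ∷ Q)  (suc v) v∉ with fromOutside-onto Q v (v∉ ∘ there)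
... | i , refl = i , refl
fromOutside-onto (false ∷ Q) (suc v) v∉ with fromOutside-onto Q v (v∉ ∘ there)
... | i , refl = suc i , refl

∈-liftSubset⁺ : ∀ {n} (Q : Subset n) S {i} → i ∈ S → fromOutside Q i ∈ liftSubset Q S
∈-liftSubset⁺ (true ∷ Q)  S       i∈        = there (∈-liftSubset⁺ Q S i∈)
∈-liftSubset⁺ (false ∷ Q) (_ ∷ S) here      = here
∈-liftSubset⁺ (false ∷ Q) (_ ∷ S) (there p) = there (∈-liftSubset⁺ Q S p)

∈-liftSubset⁻ : ∀ {n} (Q : Subset n) S i → fromOutside Q i ∈ liftSubset Q S → i ∈ S
∈-liftSubset⁻ (true ∷ Q)  S       i       (there p) = ∈-liftSubset⁻ Q S i p
∈-liftSubset⁻ (false ∷ Q) (_ ∷ S) zero    here      = here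
∈-liftSubset⁻ (false ∷ Q) (_ ∷ S) (suc i) (there p) = there (∈-liftSubset⁻ Q S i p)

∈-liftSubset-image : ∀ {n} (Q : Subset n) S v → v ∈ liftSubset Q S →
                     ∃[ i ] (fromOutside Q i ≡ v × i ∈ S)
∈-liftSubset-image (true ∷ Q) S (suc v) (there p) with ∈-liftSubset-image Q S v p
... | i , refl , i∈ = i , refl , i∈
∈-liftSubset-image (false ∷ Q) (_ ∷ S) zero here = zero , refl , here
∈-liftSubset-image (false ∷ Q) (_ ∷ S) (suc v) (there p) with ∈-liftSubset-image Q S v p
... | i , refl , i∈ = suc i , refl , there i∈

does⇒ : ∀ {P : Set} (P? : Dec P) → does P? ≡ true → P
does⇒ (yes p) _ = p

module _ (D : Digraph) where
  private
    V = Fin (size D)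

  arc? : ∀ u v → Dec (Arc D u v)
  arc? u v = arc D u v ≟ᵇ true

  arc⇒≢ : ∀ {u v} → Arc D u v → u ≢ v
  arc⇒≢ {u} uv refl with trans (sym uv) (loopless D u)
  ... | ()

  walk-snoc : ∀ {u v w k} → Walk D u v k → Arc D v w → Walk D u w (k + 1)
  walk-snoc here       vw = step vw here
  walk-snoc (step a p) vw = step a (walk-snoc p vw)

  Arc≤2 : V → V → Set
  Arc≤2 u v = u ≢ v × (Arc D u v ⊎ ∃[ w ] (Arc D u w × Arc D w v))

  Arc≤2? : ∀ u v → Dec (Arc≤2 u v)
  Arc≤2? u v = ¬? (u ≟ᶠ v) ×-dec (arc? u v ⊎-dec any? (λ w → arc? u w ×-dec arc? w v))

  squareMinus : Subset (size D) → Digraph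
  squareMinus Q = record
    { size     = sizeOutside Q
    ; arc      = λ i j → does (Arc≤2? (fromOutside Q i) (fromOutside Q j))
    ; loopless = λ i → dec-false (Arc≤2? _ _) (λ uu → proj₁ uu refl)
    }

  module _ (Q : Subset (size D)) where
    private
      D² = squareMinus Q
      ι  = fromOutside Q

    squareMinus-arc⁺ : ∀ {i j} → Arc≤2 (ι i) (ι j) → Arc D² i j
    squareMinus-arc⁺ = dec-true (Arc≤2? _ _)

    squareMinus-arc⁻ : ∀ {i j} → Arc D² i j → Arc≤2 (ι i) (ι j)
    squareMinus-arc⁻ {i} {j} = does⇒ (Arc≤2? (ι i) (ι j))

    squareMinus-walk : ∀ {i j l} → Walk D² i j l → ∃[ l′ ] (l′ ≤ 2 * l × Walk D (ι i) (ι j) l′)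
    squareMinus-walk here = 0 , z≤n , here
    squareMinus-walk {l = suc l} (step ij p) with squareMinus-walk p | squareMinus-arc⁻ ij
    ... | l′ , l′≤ , p′ | _ , inj₁ a =
      suc l′ , ≤-trans (s≤s (m≤n⇒m≤1+n l′≤)) (≤-reflexive (sym (*-suc 2 l))) , step a p′
    ... | l′ , l′≤ , p′ | _ , inj₂ (_ , a , b) =
      suc (suc l′) , ≤-trans (s≤s (s≤s l′≤)) (≤-reflexive (sym (*-suc 2 l))) , step a (step b p′)

    squareMinus-noSource : ∀ s → Independent D Q →
      ¬ (∃[ S ] IsSPseudoSource D s S) → ¬ (∃[ S ] IsSSource D² s S)
    squareMinus-noSource s indQ noPS (S , (i , i∈S) , ∣S∣≤s , src) =
      noPS (S⁺ , ((ι i , ∈-liftSubset⁺ Q S i∈S) , pseudo) ,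
            subst (_≤ s) (sym (∣liftSubset∣ Q S)) ∣S∣≤s)
      where
      S⁺ = liftSubset Q S

      inNeg⁺ : ∀ {k j} → ι k ∉ S⁺ → j ∈ S → Arc≤2 (ι k) (ι j) → InNeg D² S k
      inNeg⁺ k∉ j∈ a = (k∉ ∘ ∈-liftSubset⁺ Q S) , _ , j∈ , squareMinus-arc⁺ a

      pseudo : ∀ v → InNeg D S⁺ v → ∀ u → Arc D u v → u ≢ v → u ∈ S⁺
      pseudo v (v∉ , w , w∈ , vw) u uv _ with ∈-liftSubset-image Q S w w∈ | v ∈? Q
      ... | j , refl , j∈ | no v∉Q with fromOutside-onto Q v v∉Q
      ...   | k , refl = ⊥-elim (src k (inNeg⁺ v∉ j∈ (arc⇒≢ vw , inj₁ vw)))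
      pseudo v (v∉ , w , w∈ , vw) u uv _ | j , refl , j∈ | yes v∈Q with u ∈? S⁺
      ... | yes u∈ = u∈
      ... | no u∉ with fromOutside-onto Q u (λ u∈Q → indQ u v u∈Q v∈Q uv)
      ...   | k , refl = ⊥-elim (src k (inNeg⁺ u∉ j∈ (u≢w , inj₂ (v , uv , vw))))
        where
        u≢w : ι k ≢ ι j
        u≢w eq = u∉ (subst (_∈ S⁺) (sym eq) w∈)

    squareMinus-disjoint : ∀ {m} {Ks : Fin m → Subset (size D²)} →
      PairwiseDisjoint D² Ks → PairwiseDisjoint D (liftSubset Q ∘ Ks)
    squareMinus-disjoint {Ks = Ks} disj i j i≢j v v∈i v∈j with ∈-liftSubset-image Q (Ks i) v v∈i
    ... | k , refl , k∈ = disj i j i≢j k k∈ (∈-liftSubset⁻ Q (Ks j) k v∈j)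

    squareMinus-kernel : ∀ {q K} → Independent D Q → (∀ v → ∃[ u ] Arc D u v) →
      IsQKernel D² q K → IsQKernel D (2 * q + 1) (liftSubset Q K)
    squareMinus-kernel {q} {K} indQ inNeighbour (indK , distK) = independent , dist
      where
      independent : Independent D (liftSubset Q K)
      independent u v u∈ v∈ uv with ∈-liftSubset-image Q K u u∈ | ∈-liftSubset-image Q K v v∈
      ... | i , refl , i∈ | j , refl , j∈ = indK i j i∈ j∈ (squareMinus-arc⁺ (arc⇒≢ uv , inj₁ uv))

      distOutside : ∀ k → DistLe D (liftSubset Q K) (ι k) (2 * q)
      distOutside k with distK k
      ... | a , l , a∈ , l≤q , p with squareMinus-walk p
      ...   | l′ , l′≤ , p′ = ι a , l′ , ∈-liftSubset⁺ Q K a∈ , ≤-trans l′≤ (*-monoʳ-≤ 2 l≤q) , p′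

      dist : ∀ v → DistLe D (liftSubset Q K) v (2 * q + 1)
      dist v with v ∈? Q
      ... | no v∉Q with fromOutside-onto Q v v∉Q
      ...   | k , refl with distOutside k
      ...     | a , l , a∈ , l≤ , p = a , l , a∈ , ≤-trans l≤ (m≤m+n _ 1) , p
      dist v | yes v∈Q with inNeighbour v
      ... | u , uv with fromOutside-onto Q u (λ u∈Q → indQ u v u∈Q v∈Q uv)
      ...   | k , refl with distOutside k
      ...     | a , l , a∈ , l≤ , p = a , l + 1 , a∈ , +-monoˡ-≤ 1 l≤ , walk-snoc p uv

  inNeighbour : ∀ {s} → 1 ≤ s → ¬ (∃[ S ] IsSPseudoSource D s S) → ∀ v → ∃[ u ] Arc D u v
  inNeighbour {s} 1≤s noPS v with any? (λ u → arc? u v)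
  ... | yes found = found
  ... | no none = ⊥-elim (noPS (⁅ v ⁆ , ((v , x∈⁅x⁆ v) , noInNeg) , subst (_≤ s) (sym (∣⁅x⁆∣≡1 v)) 1≤s))
    where
    noInNeg : ∀ w → InNeg D ⁅ v ⁆ w → ∀ u → Arc D u w → u ≢ w → u ∈ ⁅ v ⁆
    noInNeg w (_ , x , x∈ , wx) = ⊥-elim (none (w , subst (Arc D w) (x∈⁅y⁆⇒x≡y v x∈) wx))

proposition5p6 : (r : ℕ) → 3 ≤ r → (β : Vec ℕ (r ∸ 1)) → (∀ i → 1 ≤ lookup β i)
    → (∀ (D′ : Digraph) → ¬ (∃[ S ] IsSSource D′ (r ∸ 2) S) → HasBetaKernel D′ β)
    → (D : Digraph) → ¬ (∃[ S ] IsSPseudoSource D (r ∸ 2) S)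
    → (Q : Subset (size D)) → Independent D Q
    → ∃[ Qs ] (PairwiseDisjoint D {r ∸ 1} Qs
    × (∀ i v → v ∈ Qs i → v ∉ Q)
    × (∀ i → IsQKernel D (2 * lookup β i + 1) (Qs i)))
proposition5p6 r 3≤r β _ hasKernel D noPS Q indQ
  with hasKernel (squareMinus D Q) (squareMinus-noSource D Q (r ∸ 2) indQ noPS)
... | Ks , disj , kernels = liftSubset Q ∘ Ks , squareMinus-disjoint D Q disj , outsideQ , kernel
  where
  outsideQ : ∀ i v → v ∈ liftSubset Q (Ks i) → v ∉ Q
  outsideQ i v v∈ with ∈-liftSubset-image Q (Ks i) v v∈
  ... | k , refl , _ = fromOutside∉ Q k

  kernel : ∀ i → IsQKernel D (2 * lookup β i + 1) (liftSubset Q (Ks i))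
  kernel i = squareMinus-kernel D Q indQ (inNeighbour D (∸-monoˡ-≤ 2 3≤r) noPS) (kernels i)
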